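{- Let $X$ be a nonempty set, let $\mathcal{F}$ be a family of subsets of $X$ which is closed under intersection and contains $X$, and let $L$ be a complete lattice. There exists a unique $L$-fuzzy set $\mu:X\to L$ such that $\mathcal{F}=\mu_L$ if and only if $|\mathcal{S}(L,\mathcal{F})|=|OI(\mathcal{F})|=1$.
   Context: An $L$-fuzzy set on $X$ is a map $\mu:X\to L$; for $p\in L$, $\mu_p=\{x\in X\mid\mu(x)\geq p\}$ and $\mu_L=\{\mu_p\mid p\in L\}$. $|A|$ denotes cardinality. For a subset $P\subseteq L$ with the induced order, "$P$ can be embedded into $L$ by $\iota_{(P,L)}$-embedding" means that the inclusion map $P\to L$ preserves all infima and the top element: for every $S\subseteq P$ the infimum of $S$ in $P$ exists and equals its infimum in $L$, and the top of $P$ is $1_L$. $\mathcal{S}(L,\mathcal{F})=\{P\subseteq L\mid P\text{ can be embedded into }L\text{ by }\iota_{(P,L)}\text{ -embedding and }(P,\leq)\cong(\mathcal{F},\supseteq)\}$. $OI(\mathcal{F})$ denotes the set of lattice isomorphisms of the lattice $(\mathcal{F},\supseteq)$ onto itself. -}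

module Defs where

open import Data.Product using (Σ; _×_; _,_; proj₁; proj₂)
open import Data.Unit using (⊤)
open import Data.Empty using (⊥)
open import Relation.Binary.PropositionalEquality using (_≡_)
open import Relation.Binary.Structures using (IsPartialOrder)

Subset : Set → Set₁
Subset A = A → Set

_⊆_ : {A : Set} → Subset A → Subset A → Set
B ⊆ C = ∀ x → B x → C x

_≐_ : {A : Set} → Subset A → Subset A → Set
B ≐ C = (B ⊆ C) × (C ⊆ B)

Whole : (X : Set) → Subset X
Whole X = λ _ → ⊤

Family : Set → Set₁
Family X = Subset X → Set

ClosedUnderIntersections : {X : Set} → Family X → Set₁
ClosedUnderIntersections {X} F =
  (I : Set) (f : I → Subset X) → (∀ i → F (f i)) → F (λ x → ∀ i → f i x)

-- Complete lattices: a partial order (w.r.t. ≡) with infima of all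
-- (small-indexed) families; suprema then exist as well.

record CompleteLattice : Set₁ where
  field
    Carrier        : Set
    _≤_            : Carrier → Carrier → Set
    isPartialOrder : IsPartialOrder _≡_ _≤_
    ⋀              : {I : Set} → (I → Carrier) → Carrier
    ⋀-lb           : {I : Set} (f : I → Carrier) (i : I) → ⋀ f ≤ f i
    ⋀-glb          : {I : Set} (f : I → Carrier) (y : Carrier) →
                     (∀ i → y ≤ f i) → y ≤ ⋀ f

  inf : Subset Carrier → Carrier
  inf S = ⋀ {Σ Carrier S} proj₁

  top : Carrier
  top = ⋀ {⊥} (λ ())

module _ (L : CompleteLattice) where
  open CompleteLattice L

  level : {X : Set} → (X → Carrier) → Carrier → Subset X
  level μ p x = p ≤ μ x

  IsLevelFamily : {X : Set} → Family X → (X → Carrier) → Set₁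
  IsLevelFamily {X} F μ =
    ((A : Subset X) → F A → Σ Carrier λ p → A ≐ level μ p) ×
    ((p : Carrier) → Σ (Subset X) λ A → F A × (A ≐ level μ p))

  UniqueFuzzySet : (X : Set) → Family X → Set₁
  UniqueFuzzySet X F =
    (Σ (X → Carrier) λ μ → IsLevelFamily F μ) ×
    ((μ μ' : X → Carrier) → IsLevelFamily F μ → IsLevelFamily F μ' →
       ∀ x → μ x ≡ μ' x)

  IsInfIn : Subset Carrier → Subset Carrier → Carrier → Set
  IsInfIn P S m =
    P m × (∀ s → S s → m ≤ s) × (∀ y → P y → (∀ s → S s → y ≤ s) → y ≤ m)

  IsTopIn : Subset Carrier → Carrier → Set
  IsTopIn P t = P t × (∀ y → P y → y ≤ t)

  ιEmbedding : Subset Carrier → Set₁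
  ιEmbedding P =
    ((S : Subset Carrier) → S ⊆ P →
       Σ Carrier λ m → IsInfIn P S m × (m ≡ inf S)) ×
    (Σ Carrier λ t → IsTopIn P t × (t ≡ top))

  record OrderIso (X : Set) (F : Family X) (P : Subset Carrier) : Set₁ where
    field
      to      : Σ Carrier P → Σ (Subset X) F
      from    : Σ (Subset X) F → Σ Carrier P
      from-to : ∀ a → proj₁ (from (to a)) ≡ proj₁ a
      to-from : ∀ B → proj₁ (to (from B)) ≐ proj₁ B
      mono    : ∀ a b → proj₁ a ≤ proj₁ b → proj₁ (to b) ⊆ proj₁ (to a)
      mono⁻¹  : ∀ a b → proj₁ (to b) ⊆ proj₁ (to a) → proj₁ a ≤ proj₁ b

  InS : (X : Set) → Family X → Subset Carrier → Set₁
  InS X F P = ιEmbedding P × OrderIso X F P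

  CardS≡1 : (X : Set) → Family X → Set₁
  CardS≡1 X F =
    (Σ (Subset Carrier) λ P → InS X F P) ×
    ((P P' : Subset Carrier) → InS X F P → InS X F P' → P ≐ P')

-- OI(F): lattice (= order) isomorphisms of (F, ⊇) onto itself

record OrderAuto (X : Set) (F : Family X) : Set₁ where
  field
    φ     : Σ (Subset X) F → Σ (Subset X) F
    ψ     : Σ (Subset X) F → Σ (Subset X) F
    ψφ    : ∀ A → proj₁ (ψ (φ A)) ≐ proj₁ A
    φψ    : ∀ A → proj₁ (φ (ψ A)) ≐ proj₁ A
    mono  : ∀ A B → proj₁ B ⊆ proj₁ A → proj₁ (φ B) ⊆ proj₁ (φ A)
    mono⁻¹ : ∀ A B → proj₁ (φ B) ⊆ proj₁ (φ A) → proj₁ B ⊆ proj₁ A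

SameAuto : {X : Set} {F : Family X} → OrderAuto X F → OrderAuto X F → Set₁
SameAuto α β = ∀ A → proj₁ (OrderAuto.φ α A) ≐ proj₁ (OrderAuto.φ β A)

CardOI≡1 : (X : Set) → Family X → Set₁
CardOI≡1 X F =
  OrderAuto X F × ((α β : OrderAuto X F) → SameAuto α β)

-- A level family μ of F (i.e. F = μ_L) is determined by its realised levels
-- P_μ = {q | ⋀ μ(μ_q) = q}: this set is closed under infima, and A ↦ ⋀ μ(A) is an
-- order anti-isomorphism F ≅ P_μ inverse to q ↦ μ_q.  Conversely, every P ∈ S(L,F)
-- with an isomorphism T : P ≅ (F,⊇) induces a level family μ_T, where μ_T x is the
-- level T assigns to the smallest member of F containing x, and P = P_{μ_T}; moreover
-- T q = (μ_T)_q.  Hence if μ is unique, every P ∈ S(L,F) equals P_μ, and every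
-- automorphism α of F is trivial because T and α ∘ T induce the same μ.  Conversely, if
-- μ, μ' are level families then P_μ = P_μ', so A ↦ μ'_{⋀ μ(A)} is an automorphism of F;
-- being the identity, it shows that ⋀ μ and ⋀ μ' agree on F, which forces μ = μ'.
module Submission where

open import Defs
open import Data.Empty using (⊥)
open import Data.Product using (Σ; _×_; _,_; proj₁; proj₂)
open import Function.Base using (_∘_)
open import Function.Bundles using (_⇔_; mk⇔)
open import Relation.Binary.PropositionalEquality
  using (_≡_; _≗_; refl; sym; trans; subst; subst₂; module ≡-Reasoning)
open import Relation.Binary.Structures using (IsPartialOrder)

module _ {A : Set} where

  ≐-sym : {B C : Subset A} → B ≐ C → C ≐ B
  ≐-sym (B⊆C , C⊆B) = C⊆B , B⊆C

  ≐-trans : {B C D : Subset A} → B ≐ C → C ≐ D → B ≐ D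
  ≐-trans (B⊆C , C⊆B) (C⊆D , D⊆C) =
    (λ x h → C⊆D x (B⊆C x h)) , (λ x h → C⊆B x (D⊆C x h))

module _ {X : Set} {F : Family X} where

  OrderAuto-id : OrderAuto X F
  OrderAuto-id = record
    { φ = λ A → A
    ; ψ = λ A → A
    ; ψφ = λ _ → (λ _ h → h) , (λ _ h → h)
    ; φψ = λ _ → (λ _ h → h) , (λ _ h → h)
    ; mono = λ _ _ B⊆A → B⊆A
    ; mono⁻¹ = λ _ _ B⊆A → B⊆A
    }

  φ-cong : (α : OrderAuto X F) {A B : Σ (Subset X) F} →
           proj₁ A ≐ proj₁ B → proj₁ (OrderAuto.φ α A) ≐ proj₁ (OrderAuto.φ α B)
  φ-cong α {A} {B} (A⊆B , B⊆A) = OrderAuto.mono α B A A⊆B , OrderAuto.mono α A B B⊆A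

module _ (L : CompleteLattice) where
  open CompleteLattice L
  open IsPartialOrder isPartialOrder using (antisym) renaming (refl to ≤-refl; trans to ≤-trans)

  top-greatest : ∀ y → y ≤ top
  top-greatest y = ⋀-glb (λ ()) y (λ ())

  inf-lb : (S : Subset Carrier) → ∀ s → S s → inf S ≤ s
  inf-lb S s Ss = ⋀-lb proj₁ (s , Ss)

  inf-glb : (S : Subset Carrier) → ∀ y → (∀ s → S s → y ≤ s) → y ≤ inf S
  inf-glb S y lb = ⋀-glb proj₁ y (λ (s , Ss) → lb s Ss)

  inf-∅≡top : inf (λ _ → ⊥) ≡ top
  inf-∅≡top = antisym (top-greatest _) (inf-glb _ top (λ _ ()))

  InfClosed : Subset Carrier → Set₁
  InfClosed P = (S : Subset Carrier) → S ⊆ P → P (inf S)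

  InfClosed⇒ιEmbedding : {P : Subset Carrier} → InfClosed P → ιEmbedding L P
  InfClosed⇒ιEmbedding {P} closed = infima , top , (P-top , λ y _ → top-greatest y) , refl
    where
    infima : (S : Subset Carrier) → S ⊆ P → Σ Carrier λ m → IsInfIn L P S m × (m ≡ inf S)
    infima S S⊆P = inf S , (closed S S⊆P , inf-lb S , λ y _ → inf-glb S y) , refl

    P-top : P top
    P-top = subst P inf-∅≡top (closed _ (λ _ ()))

  ιEmbedding⇒InfClosed : {P : Subset Carrier} → ιEmbedding L P → InfClosed P
  ιEmbedding⇒InfClosed {P} (infima , _) S S⊆P with infima S S⊆P
  ... | m , (Pm , _) , m≡inf = subst P m≡inf Pm

  module _ {X : Set} where

    ⋀-on : (X → Carrier) → Subset X → Carrier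
    ⋀-on μ A = ⋀ {Σ X A} (μ ∘ proj₁)

    ⋀-on-lb : (μ : X → Carrier) {A : Subset X} {x : X} → A x → ⋀-on μ A ≤ μ x
    ⋀-on-lb μ {x = x} Ax = ⋀-lb (μ ∘ proj₁) (x , Ax)

    ⋀-on-glb : (μ : X → Carrier) {A : Subset X} {y : Carrier} →
               (∀ x → A x → y ≤ μ x) → y ≤ ⋀-on μ A
    ⋀-on-glb μ {y = y} lb = ⋀-glb (μ ∘ proj₁) y (λ (x , Ax) → lb x Ax)

    ⋀-on-antitone : (μ : X → Carrier) {A B : Subset X} → A ⊆ B → ⋀-on μ B ≤ ⋀-on μ A
    ⋀-on-antitone μ A⊆B = ⋀-on-glb μ (λ x Ax → ⋀-on-lb μ (A⊆B x Ax))

    ⋀-on-resp-≐ : (μ : X → Carrier) {A B : Subset X} → A ≐ B → ⋀-on μ A ≡ ⋀-on μ B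
    ⋀-on-resp-≐ μ (A⊆B , B⊆A) = antisym (⋀-on-antitone μ B⊆A) (⋀-on-antitone μ A⊆B)

    ⋀-on-cong : {μ μ' : X → Carrier} → μ ≗ μ' → (A : Subset X) → ⋀-on μ A ≡ ⋀-on μ' A
    ⋀-on-cong {μ} {μ'} μ≗μ' A = antisym
      (⋀-on-glb μ' (λ x Ax → subst (⋀-on μ A ≤_) (μ≗μ' x) (⋀-on-lb μ Ax)))
      (⋀-on-glb μ (λ x Ax → subst (⋀-on μ' A ≤_) (sym (μ≗μ' x)) (⋀-on-lb μ' Ax)))

    inf-image≡⋀-on : (μ : X → Carrier) (A : Subset X) →
                     inf (λ r → Σ X λ x → A x × (r ≡ μ x)) ≡ ⋀-on μ A
    inf-image≡⋀-on μ A = antisym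
      (⋀-on-glb μ (λ x Ax → inf-lb _ (μ x) (x , Ax , refl)))
      (inf-glb _ _ (λ { r (x , Ax , refl) → ⋀-on-lb μ Ax }))

    level-antitone : (μ : X → Carrier) {p q : Carrier} → p ≤ q → level L μ q ⊆ level L μ p
    level-antitone μ p≤q x q≤μx = ≤-trans p≤q q≤μx

    level-cong : {μ μ' : X → Carrier} → μ ≗ μ' → (q : Carrier) → level L μ q ≐ level L μ' q
    level-cong {μ} {μ'} μ≗μ' q =
      (λ x → subst (q ≤_) (μ≗μ' x)) , (λ x → subst (q ≤_) (sym (μ≗μ' x)))

    ≤-⋀-on-level : (μ : X → Carrier) (q : Carrier) → q ≤ ⋀-on μ (level L μ q)
    ≤-⋀-on-level μ q = ⋀-on-glb μ (λ _ q≤μx → q≤μx)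

    Realised : (X → Carrier) → Subset Carrier
    Realised μ q = ⋀-on μ (level L μ q) ≡ q

    Realised-cong : {μ μ' : X → Carrier} → μ ≗ μ' → Realised μ ⊆ Realised μ'
    Realised-cong {μ} {μ'} μ≗μ' q realised = begin
      ⋀-on μ' (level L μ' q) ≡⟨ ⋀-on-resp-≐ μ' (≐-sym (level-cong μ≗μ' q)) ⟩
      ⋀-on μ' (level L μ q)  ≡⟨ sym (⋀-on-cong μ≗μ' _) ⟩
      ⋀-on μ (level L μ q)   ≡⟨ realised ⟩
      q                      ∎
      where open ≡-Reasoning

    Realised-InfClosed : (μ : X → Carrier) → InfClosed (Realised μ)
    Realised-InfClosed μ S S⊆R = antisym
      (inf-glb S _ λ s Ss → subst (⋀-on μ (level L μ (inf S)) ≤_) (S⊆R s Ss)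
        (⋀-on-antitone μ (level-antitone μ (inf-lb S s Ss))))
      (≤-⋀-on-level μ (inf S))

    Realised-ιEmbedding : (μ : X → Carrier) → ιEmbedding L (Realised μ)
    Realised-ιEmbedding μ = InfClosed⇒ιEmbedding (Realised-InfClosed μ)

  module LevelFamily {X : Set} {F : Family X} {μ : X → Carrier}
                     (H : IsLevelFamily L F μ) where

    levelRep : Carrier → Σ (Subset X) F
    levelRep p = proj₁ (proj₂ H p) , proj₁ (proj₂ (proj₂ H p))

    levelRep-≐ : (p : Carrier) → proj₁ (levelRep p) ≐ level L μ p
    levelRep-≐ p = proj₂ (proj₂ (proj₂ H p))

    level-⋀-on : {A : Subset X} → F A → level L μ (⋀-on μ A) ≐ A
    level-⋀-on {A} FA with proj₁ H A FA
    ... | p , A⊆μp , μp⊆A =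
      (λ x h → μp⊆A x (≤-trans (⋀-on-glb μ A⊆μp) h)) , (λ x Ax → ⋀-on-lb μ Ax)

    realisedIso : OrderIso L X F (Realised μ)
    realisedIso = record
      { to = λ (q , _) → levelRep q
      ; from = λ (A , FA) → ⋀-on μ A , ⋀-on-resp-≐ μ (level-⋀-on FA)
      ; from-to = λ (q , realised) → trans (⋀-on-resp-≐ μ (levelRep-≐ q)) realised
      ; to-from = λ (A , FA) → ≐-trans (levelRep-≐ _) (level-⋀-on FA)
      ; mono = λ (p , _) (q , _) p≤q x h →
          proj₂ (levelRep-≐ p) x (level-antitone μ p≤q x (proj₁ (levelRep-≐ q) x h))
      ; mono⁻¹ = λ (p , realised-p) (q , realised-q) q⊆p →
          subst₂ _≤_ realised-p realised-q (⋀-on-antitone μ λ x h →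
            proj₁ (levelRep-≐ p) x (q⊆p x (proj₂ (levelRep-≐ q) x h)))
      }

    level-family-≤ : {μ' : X → Carrier} →
                     (∀ A → F A → ⋀-on μ A ≤ ⋀-on μ' A) → ∀ x → μ x ≤ μ' x
    level-family-≤ {μ'} ⋀μ≤⋀μ' x =
      ≤-trans (⋀-on-glb μ A⊆) (≤-trans (⋀μ≤⋀μ' A FA) (⋀-on-lb μ' (⊆A x ≤-refl)))
      where
      A = proj₁ (levelRep (μ x))
      FA = proj₂ (levelRep (μ x))
      A⊆ = proj₁ (levelRep-≐ (μ x))
      ⊆A = proj₂ (levelRep-≐ (μ x))

  ⋀-on-agree⇒≗ : {X : Set} {F : Family X} {μ μ' : X → Carrier} →
                 IsLevelFamily L F μ → IsLevelFamily L F μ' →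
                 (∀ A → F A → ⋀-on μ A ≡ ⋀-on μ' A) → μ ≗ μ'
  ⋀-on-agree⇒≗ H H' agree x = antisym
    (LevelFamily.level-family-≤ H (λ A FA → subst (⋀-on _ A ≤_) (agree A FA) ≤-refl) x)
    (LevelFamily.level-family-≤ H' (λ A FA → subst (_≤ ⋀-on _ A) (agree A FA) ≤-refl) x)

  module OrderIsoProperties {X : Set} {F : Family X} {P : Subset Carrier}
                            (T : OrderIso L X F P) where
    open OrderIso T

    to-cong : {a b : Σ Carrier P} → proj₁ a ≡ proj₁ b → proj₁ (to a) ≐ proj₁ (to b)
    to-cong {a} {b} a≡b =
      mono b a (subst (_≤ proj₁ a) a≡b ≤-refl) , mono a b (subst (proj₁ a ≤_) a≡b ≤-refl)

    from-antitone : {A B : Σ (Subset X) F} → proj₁ A ⊆ proj₁ B →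
                    proj₁ (from B) ≤ proj₁ (from A)
    from-antitone {A} {B} A⊆B = mono⁻¹ (from B) (from A)
      (λ x h → proj₂ (to-from B) x (A⊆B x (proj₁ (to-from A) x h)))

    from-cong : {A B : Σ (Subset X) F} → proj₁ A ≐ proj₁ B → proj₁ (from A) ≡ proj₁ (from B)
    from-cong (A⊆B , B⊆A) = antisym (from-antitone B⊆A) (from-antitone A⊆B)

  module _ {X : Set} {F : Family X} where

    postcompose : {P : Subset Carrier} → OrderIso L X F P → OrderAuto X F → OrderIso L X F P
    postcompose T α = record
      { to = φ ∘ to
      ; from = from ∘ ψ
      ; from-to = λ a → trans (from-cong (ψφ (to a))) (from-to a)
      ; to-from = λ B → ≐-trans (φ-cong α (to-from (ψ B))) (φψ B)
      ; mono = λ a b a≤b → α.mono (to a) (to b) (mono a b a≤b)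
      ; mono⁻¹ = λ a b s → mono⁻¹ a b (α.mono⁻¹ (to a) (to b) s)
      }
      where
      open OrderIso T
      open OrderIsoProperties T
      module α = OrderAuto α
      open α using (φ; ψ; ψφ; φψ)

    module _ {P P' : Subset Carrier} (P≐P' : P ≐ P')
             (T : OrderIso L X F P) (T' : OrderIso L X F P') where
      private
        module T = OrderIso T
        module T' = OrderIso T'
        module Tp = OrderIsoProperties T

        forth : Σ Carrier P → Σ Carrier P'
        forth (q , Pq) = q , proj₁ P≐P' q Pq

        back : Σ Carrier P' → Σ Carrier P
        back (q , P'q) = q , proj₂ P≐P' q P'q

      autoBetween : OrderAuto X F
      autoBetween = record
        { φ = T'.to ∘ forth ∘ T.from
        ; ψ = T.to ∘ back ∘ T'.from
        ; ψφ = λ A → ≐-trans (Tp.to-cong (T'.from-to (forth (T.from A)))) (T.to-from A)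
        ; φψ = λ A → ≐-trans (OrderIsoProperties.to-cong T' (T.from-to (back (T'.from A))))
                             (T'.to-from A)
        ; mono = λ A B B⊆A →
            T'.mono (forth (T.from A)) (forth (T.from B)) (Tp.from-antitone B⊆A)
        ; mono⁻¹ = λ A B s x h →
            proj₁ (T.to-from A) x
              (T.mono (T.from A) (T.from B) (T'.mono⁻¹ (forth (T.from A)) (forth (T.from B)) s)
                x (proj₂ (T.to-from B) x h))
        }

      from-autoBetween : (A : Σ (Subset X) F) →
                         proj₁ (T'.from (OrderAuto.φ autoBetween A)) ≡ proj₁ (T.from A)
      from-autoBetween A = T'.from-to (forth (T.from A))

  module InducedFuzzySet {X : Set} {F : Family X} (closed : ClosedUnderIntersections F)
                         {P : Subset Carrier} (ιP : ιEmbedding L P)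
                         (T : OrderIso L X F P) where
    open OrderIso T

    Containing : X → Set
    Containing x = Σ (Σ Carrier P) λ q → proj₁ (to q) x

    hull : X → Σ (Subset X) F
    hull x = (λ y → (c : Containing x) → proj₁ (to (proj₁ c)) y)
           , closed (Containing x) (proj₁ ∘ to ∘ proj₁) (proj₂ ∘ to ∘ proj₁)

    μ : X → Carrier
    μ x = proj₁ (from (hull x))

    μ∈P : ∀ x → P (μ x)
    μ∈P x = proj₂ (from (hull x))

    level≐to : (q : Σ Carrier P) → level L μ (proj₁ q) ≐ proj₁ (to q)
    level≐to q =
      (λ x q≤μx → mono q (from (hull x)) q≤μx x (proj₂ (to-from (hull x)) x proj₂)) ,
      (λ x x∈q → mono⁻¹ q (from (hull x)) (λ y h → proj₁ (to-from (hull x)) y h (q , x∈q)))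

    ⋀-on-μ∈P : (A : Subset X) → P (⋀-on μ A)
    ⋀-on-μ∈P A = subst P (inf-image≡⋀-on μ A)
      (ιEmbedding⇒InfClosed ιP _ (λ { r (x , _ , refl) → μ∈P x }))

    isLevelFamily : IsLevelFamily L F μ
    isLevelFamily = levelOfMember , memberAtLevel
      where
      levelOfMember : (A : Subset X) → F A → Σ Carrier λ p → A ≐ level L μ p
      levelOfMember A FA = proj₁ (from (A , FA))
                         , ≐-trans (≐-sym (to-from (A , FA))) (≐-sym (level≐to (from (A , FA))))

      -- the least level of P above p has the same level set as p
      memberAtLevel : (p : Carrier) → Σ (Subset X) λ A → F A × (A ≐ level L μ p)
      memberAtLevel p = proj₁ (to m) , proj₂ (to m) , ≐-trans (≐-sym (level≐to m)) μm≐μp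
        where
        above : Subset Carrier
        above q = P q × p ≤ q

        m : Σ Carrier P
        m = inf above , ιEmbedding⇒InfClosed ιP above (λ _ → proj₁)

        μm≐μp : level L μ (proj₁ m) ≐ level L μ p
        μm≐μp = level-antitone μ (inf-glb above p (λ _ → proj₂))
              , (λ x p≤μx → inf-lb above (μ x) (μ∈P x , p≤μx))

    P≐Realised : P ≐ Realised μ
    P≐Realised = P⊆Realised , (λ q realised → subst P realised (⋀-on-μ∈P _))
      where
      P⊆Realised : P ⊆ Realised μ
      P⊆Realised q Pq = antisym (mono⁻¹ r (q , Pq) to-q⊆to-r) (≤-⋀-on-level μ q)
        where
        r : Σ Carrier P
        r = ⋀-on μ (level L μ q) , ⋀-on-μ∈P _

        to-q⊆to-r : proj₁ (to (q , Pq)) ⊆ proj₁ (to r)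
        to-q⊆to-r x h = proj₁ (level≐to r) x (⋀-on-lb μ (proj₂ (level≐to (q , Pq)) x h))

  module _ {X : Set} {F : Family X} (closed : ClosedUnderIntersections F) where

    UniqueFuzzySet⇒CardS≡1×CardOI≡1 : UniqueFuzzySet L X F → CardS≡1 L X F × CardOI≡1 X F
    UniqueFuzzySet⇒CardS≡1×CardOI≡1 ((μ₀ , H₀) , unique) =
      ( (Realised μ₀ , Realised-ιEmbedding μ₀ , realisedIso)
      , (λ _ _ s s' → ≐-trans (P≐Realised₀ s) (≐-sym (P≐Realised₀ s'))) )
      , ( OrderAuto-id
        , (λ α β A → ≐-trans (φ≐id α A) (≐-sym (φ≐id β A))) )
      where
      open LevelFamily H₀ using (realisedIso)

      induced≗μ₀ : {P : Subset Carrier} (ιP : ιEmbedding L P) (T : OrderIso L X F P) →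
                   InducedFuzzySet.μ closed ιP T ≗ μ₀
      induced≗μ₀ ιP T = unique _ μ₀ (InducedFuzzySet.isLevelFamily closed ιP T) H₀

      P≐Realised₀ : {P : Subset Carrier} → InS L X F P → P ≐ Realised μ₀
      P≐Realised₀ (ιP , T) = ≐-trans (InducedFuzzySet.P≐Realised closed ιP T)
        (Realised-cong (induced≗μ₀ ιP T) , Realised-cong (sym ∘ induced≗μ₀ ιP T))

      to≐level₀ : {P : Subset Carrier} (ιP : ιEmbedding L P) (T : OrderIso L X F P) →
                  (q : Σ Carrier P) → proj₁ (OrderIso.to T q) ≐ level L μ₀ (proj₁ q)
      to≐level₀ ιP T q = ≐-trans (≐-sym (InducedFuzzySet.level≐to closed ιP T q))
                                 (level-cong (induced≗μ₀ ιP T) (proj₁ q))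

      -- T and α ∘ T induce the same fuzzy set μ₀, hence agree as maps into F
      φ≐id : (α : OrderAuto X F) (A : Σ (Subset X) F) → proj₁ (OrderAuto.φ α A) ≐ proj₁ A
      φ≐id α A = ≐-trans (φ-cong α (≐-sym (to-from A)))
        (≐-trans (to≐level₀ ι (postcompose realisedIso α) (from A))
          (≐-trans (≐-sym (to≐level₀ ι realisedIso (from A))) (to-from A)))
        where
        open OrderIso realisedIso using (to-from; from)
        ι = Realised-ιEmbedding μ₀

    CardS≡1×CardOI≡1⇒UniqueFuzzySet : CardS≡1 L X F × CardOI≡1 X F → UniqueFuzzySet L X F
    CardS≡1×CardOI≡1⇒UniqueFuzzySet (((P , ιP , T) , S-unique) , (_ , OI-unique)) =
      (μ , isLevelFamily) , uniqueness
      where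
      open InducedFuzzySet closed ιP T using (μ; isLevelFamily)

      uniqueness : (μ₁ μ₂ : X → Carrier) →
                   IsLevelFamily L F μ₁ → IsLevelFamily L F μ₂ → μ₁ ≗ μ₂
      uniqueness μ₁ μ₂ H₁ H₂ = ⋀-on-agree⇒≗ H₁ H₂ agree
        where
        T₁ : OrderIso L X F (Realised μ₁)
        T₁ = LevelFamily.realisedIso H₁

        T₂ : OrderIso L X F (Realised μ₂)
        T₂ = LevelFamily.realisedIso H₂

        R₁≐R₂ : Realised μ₁ ≐ Realised μ₂
        R₁≐R₂ = S-unique _ _ (Realised-ιEmbedding μ₁ , T₁) (Realised-ιEmbedding μ₂ , T₂)

        α : OrderAuto X F
        α = autoBetween R₁≐R₂ T₁ T₂

        agree : ∀ A → F A → ⋀-on μ₁ A ≡ ⋀-on μ₂ A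
        agree A FA = trans (sym (from-autoBetween R₁≐R₂ T₁ T₂ (A , FA)))
          (OrderIsoProperties.from-cong T₂ {OrderAuto.φ α (A , FA)} {A , FA}
            (OI-unique α OrderAuto-id (A , FA)))

theorem11 : (X : Set) → X → (F : Family X) →
            ClosedUnderIntersections F → F (Whole X) →
            (L : CompleteLattice) →
            UniqueFuzzySet L X F ⇔ (CardS≡1 L X F × CardOI≡1 X F)
theorem11 X _ F closed _ L =
  mk⇔ (UniqueFuzzySet⇒CardS≡1×CardOI≡1 L closed) (CardS≡1×CardOI≡1⇒UniqueFuzzySet L closed)
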